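{- Let $\sigma_{even}(n)$ denote the sum of the even positive divisors of $n$ (with $\sigma_{even}(n)=0$ for $n\le 0$), and $\sigma_{even}^{*2}(n)=\sum_{a+b=n,\ a,b\ge 0}\sigma_{even}(a)\sigma_{even}(b)$. Then for all integers $n\ge 0$, \[ \sigma_{even}^{*2}(5n+2)\equiv 0\pmod 5\qquad\text{and}\qquad \sigma_{even}^{*2}(7n+5)\equiv 0\pmod 7. \] -}

module Defs where

open import Data.Nat using (ℕ; zero; suc; _+_; _*_; _∸_; _%_)
open import Data.Nat.Divisibility using (_∣_; _∣?_)
open import Data.List using (List; []; _∷_; map; filter)
open import Data.Nat.ListAction using (sum)
open import Data.List.Base using (upTo)
open import Relation.Nullary.Decidable using (_×-dec_)
open import Data.Bool using (if_then_else_)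

range1 : ℕ → List ℕ
range1 n = map suc (upTo n)

σeven : ℕ → ℕ
σeven n = sum (filter (λ d → (2 ∣? d) ×-dec (d ∣? n)) (range1 n))

σeven*2 : ℕ → ℕ
σeven*2 n = sum (map (λ a → σeven a * σeven (n ∸ a)) (upTo (suc n)))

-- Since σeven n = 2 σ (n / 2) for even n and 0 for odd n, σeven*2 vanishes at odd arguments and
-- σeven*2 (2 K) = 4 ∑_{u+v=K} σ(u) σ(v). Following Liouville, write the convolution as a sum over the
-- solutions of K = a x + b y in positive integers; splitting the solutions according to x < y, x = y,
-- x > y and to a < b, a = b, a > b, and shearing (a, y) ↦ (a + b, y − x) on one part, yields
--   24 ∑_{u+v=K} σ(u) σ(v) + ∑_{dm=K} 6 (d² (m − 1) + m² (d − 1)) = ∑_{dm=K} ((m − 1) m (5m − 1) + (d − 1) d (5d − 1)),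
-- which is Besge's formula 12 ∑ σ(u) σ(v) = 5 σ₃(K) + (1 − 6K) σ(K). When K ≡ 1 (mod 5), resp. K ≡ 6 (mod 7),
-- the two divisor sums agree term by term modulo 5, resp. 7; this only depends on d and m modulo p and is
-- checked on all residues. Finally 5n + 2 and 7n + 5 are either odd or of the form 2K with such K.

module Submission where

open import Defs
open import Data.Nat
open import Data.Nat.Properties
open import Data.Nat.DivMod
open import Data.Nat.Divisibility
open import Data.Nat.Coprimality using (Coprime; coprime?; coprime-divisor)
open import Data.List using ([]; _∷_; map; filter; upTo; applyUpTo)
open import Data.Nat.ListAction using (sum)
open import Data.Product using (_×_; _,_; ∃)
open import Data.Sum using (_⊎_; inj₁; inj₂)
open import Function using (_∘_; id)
open import Relation.Binary.PropositionalEquality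
open import Relation.Binary.Definitions using (tri<; tri≈; tri>)
open import Relation.Nullary using (Dec; yes; no; ¬_)
open import Relation.Nullary.Decidable using (_×-dec_; _→-dec_; toWitness)
open import Relation.Nullary.Negation using (contradiction)
open import Relation.Unary using (Pred; Decidable)
open import Data.Nat.Tactic.RingSolver using (solve-∀; solve)
open import Algebra.Properties.CommutativeSemigroup *-commutativeSemigroup using (x∙yz≈y∙xz)

open ≡-Reasoning

-- Finite sums and indicators

∑ : ℕ → (ℕ → ℕ) → ℕ
∑ zero    f = 0
∑ (suc n) f = f 0 + ∑ n (f ∘ suc)

syntax ∑ n (λ i → e) = ∑[ i < n ] e

∑-cong< : ∀ n {f g : ℕ → ℕ} → (∀ i → i < n → f i ≡ g i) → ∑ n f ≡ ∑ n g
∑-cong< zero    eq = refl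
∑-cong< (suc n) eq = cong₂ _+_ (eq 0 z<s) (∑-cong< n (λ i i<n → eq (suc i) (s<s i<n)))

∑-cong : ∀ n {f g : ℕ → ℕ} → (∀ i → f i ≡ g i) → ∑ n f ≡ ∑ n g
∑-cong n eq = ∑-cong< n (λ i _ → eq i)

∑-distrib-+ : ∀ n (f g : ℕ → ℕ) → ∑[ i < n ] (f i + g i) ≡ ∑ n f + ∑ n g
∑-distrib-+ zero    f g = refl
∑-distrib-+ (suc n) f g = begin
  f 0 + g 0 + ∑[ i < n ] (f (suc i) + g (suc i))  ≡⟨ cong (f 0 + g 0 +_) (∑-distrib-+ n (f ∘ suc) (g ∘ suc)) ⟩
  f 0 + g 0 + (∑ n (f ∘ suc) + ∑ n (g ∘ suc))     ≡⟨ +-exchange (f 0) (g 0) _ _ ⟩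
  f 0 + ∑ n (f ∘ suc) + (g 0 + ∑ n (g ∘ suc))     ∎
  where
  +-exchange : ∀ a b c d → a + b + (c + d) ≡ a + c + (b + d)
  +-exchange = solve-∀

∑-*ˡ : ∀ n c (f : ℕ → ℕ) → ∑[ i < n ] (c * f i) ≡ c * ∑ n f
∑-*ˡ zero    c f = sym (*-zeroʳ c)
∑-*ˡ (suc n) c f = trans (cong (c * f 0 +_) (∑-*ˡ n c (f ∘ suc))) (sym (*-distribˡ-+ c (f 0) _))

∑-*ʳ : ∀ n c (f : ℕ → ℕ) → ∑[ i < n ] (f i * c) ≡ ∑ n f * c
∑-*ʳ n c f = begin
  ∑[ i < n ] (f i * c)  ≡⟨ ∑-cong n (λ i → *-comm (f i) c) ⟩
  ∑[ i < n ] (c * f i)  ≡⟨ ∑-*ˡ n c f ⟩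
  c * ∑ n f             ≡⟨ *-comm c _ ⟩
  ∑ n f * c             ∎

∑-zero : ∀ n → ∑[ i < n ] 0 ≡ 0
∑-zero zero    = refl
∑-zero (suc n) = ∑-zero n

∑-vanishing : ∀ n {f : ℕ → ℕ} → (∀ i → i < n → f i ≡ 0) → ∑ n f ≡ 0
∑-vanishing n eq = trans (∑-cong< n eq) (∑-zero n)

∑-comm : ∀ n m (f : ℕ → ℕ → ℕ) → ∑[ i < n ] ∑[ j < m ] f i j ≡ ∑[ j < m ] ∑[ i < n ] f i j
∑-comm zero    m f = sym (∑-zero m)
∑-comm (suc n) m f = begin
  ∑ m (f 0) + ∑[ i < n ] ∑[ j < m ] f (suc i) j  ≡⟨ cong (∑ m (f 0) +_) (∑-comm n m (f ∘ suc)) ⟩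
  ∑ m (f 0) + ∑[ j < m ] ∑[ i < n ] f (suc i) j  ≡⟨ ∑-distrib-+ m (f 0) _ ⟨
  ∑[ j < m ] (f 0 j + ∑[ i < n ] f (suc i) j)    ∎

∑-+ : ∀ m n (f : ℕ → ℕ) → ∑ (m + n) f ≡ ∑ m f + ∑[ i < n ] f (m + i)
∑-+ zero    n f = refl
∑-+ (suc m) n f = trans (cong (f 0 +_) (∑-+ m n (f ∘ suc))) (sym (+-assoc (f 0) _ _))

∑-sucʳ : ∀ n (f : ℕ → ℕ) → ∑ (suc n) f ≡ ∑ n f + f n
∑-sucʳ n f = begin
  ∑ (suc n) f              ≡⟨ cong (λ k → ∑ k f) (+-comm 1 n) ⟩
  ∑ (n + 1) f              ≡⟨ ∑-+ n 1 f ⟩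
  ∑ n f + (f (n + 0) + 0)  ≡⟨ cong (λ k → ∑ n f + k) (trans (+-identityʳ _) (cong f (+-identityʳ n))) ⟩
  ∑ n f + f n              ∎

∑-extend : ∀ n m (f : ℕ → ℕ) → n ≤ m → (∀ i → n ≤ i → f i ≡ 0) → ∑ m f ≡ ∑ n f
∑-extend n m f n≤m vanish with m≤n⇒∃[o]m+o≡n n≤m
... | k , refl = begin
  ∑ (n + k) f                   ≡⟨ ∑-+ n k f ⟩
  ∑ n f + ∑[ i < k ] f (n + i)  ≡⟨ cong (∑ n f +_) (∑-vanishing k (λ i _ → vanish (n + i) (m≤m+n n i))) ⟩
  ∑ n f + 0                     ≡⟨ +-identityʳ _ ⟩
  ∑ n f                         ∎

χ : ∀ {p} {P : Set p} → Dec P → ℕ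
χ (yes _) = 1
χ (no _)  = 0

χ-yes : ∀ {p} {P : Set p} (P? : Dec P) → P → χ P? ≡ 1
χ-yes (yes _) _  = refl
χ-yes (no ¬p) p = contradiction p ¬p

χ-no : ∀ {p} {P : Set p} (P? : Dec P) → ¬ P → χ P? ≡ 0
χ-no (yes p) ¬p = contradiction p ¬p
χ-no (no _)  _  = refl

χ-cong : ∀ {p q} {P : Set p} {Q : Set q} (P? : Dec P) (Q? : Dec Q) → (P → Q) → (Q → P) → χ P? ≡ χ Q?
χ-cong (yes p) Q? to from = sym (χ-yes Q? (to p))
χ-cong (no ¬p) Q? to from = sym (χ-no Q? (¬p ∘ from))

χ-× : ∀ {a b} {A : Set a} {B : Set b} (A? : Dec A) (B? : Dec B) → χ (A? ×-dec B?) ≡ χ A? * χ B?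
χ-× (yes a) (yes b) = refl
χ-× (yes a) (no ¬b) = refl
χ-× (no ¬a) B?      = refl

χ-trichotomy : ∀ x y → χ (x <? y) + χ (x ≟ y) + χ (y <? x) ≡ 1
χ-trichotomy x y with <-cmp x y
... | tri< x<y x≢y x≯y rewrite χ-yes (x <? y) x<y | χ-no (x ≟ y) x≢y | χ-no (y <? x) x≯y = refl
... | tri≈ x≮y x≡y x≯y rewrite χ-no (x <? y) x≮y | χ-yes (x ≟ y) x≡y | χ-no (y <? x) x≯y = refl
... | tri> x≮y x≢y x>y rewrite χ-no (x <? y) x≮y | χ-no (x ≟ y) x≢y | χ-yes (y <? x) x>y = refl

sgn : ℕ → ℕ
sgn zero    = 0
sgn (suc _) = 1

sgn-∸ : ∀ {i m} → i < m → sgn (m ∸ i) ≡ 1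
sgn-∸ {zero}  {suc m} _         = refl
sgn-∸ {suc i} {suc m} (s<s i<m) = sgn-∸ i<m

∑-χ-unique : ∀ n {p} {P : ℕ → Set p} (P? : ∀ i → Dec (P i)) (f : ℕ → ℕ) s →
             (∀ i → P i → i ≡ s) → P s → s < n → ∑[ i < n ] (χ (P? i) * f i) ≡ f s
∑-χ-unique (suc n) P? f zero unique ps _ with P? 0
... | no ¬p = contradiction ps ¬p
... | yes _ = begin
  f 0 + 0 + ∑[ i < n ] (χ (P? (suc i)) * f (suc i))  ≡⟨ cong (f 0 + 0 +_) (∑-vanishing n (λ i _ → others i)) ⟩
  f 0 + 0 + 0                                        ≡⟨ trans (+-identityʳ _) (+-identityʳ _) ⟩
  f 0                                                ∎
  where
  others : ∀ i → χ (P? (suc i)) * f (suc i) ≡ 0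
  others i with P? (suc i)
  ... | yes q with () ← unique (suc i) q
  ... | no _ = refl
∑-χ-unique (suc n) P? f (suc s) unique ps (s<s s<n) with P? 0
... | yes q with () ← unique 0 q
... | no _ = ∑-χ-unique n (P? ∘ suc) (f ∘ suc) s (λ i p → suc-injective (unique (suc i) p)) ps s<n

∑-χ-none : ∀ n {p} {P : ℕ → Set p} (P? : ∀ i → Dec (P i)) (f : ℕ → ℕ) →
           (∀ i → i < n → ¬ P i) → ∑[ i < n ] (χ (P? i) * f i) ≡ 0
∑-χ-none n P? f none = ∑-vanishing n (λ i i<n → cong (_* f i) (χ-no (P? i) (none i i<n)))

∑-sgn : ∀ n (f : ℕ → ℕ) → f n ≡ 0 → ∑[ j < n ] (sgn j * f j) ≡ ∑[ i < n ] f (suc i)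
∑-sgn n f fn≡0 = +-cancelʳ-≡ 0 _ _ (begin
  ∑[ j < n ] (sgn j * f j) + 0
    ≡⟨ cong (∑[ j < n ] (sgn j * f j) +_) (trans (cong (sgn n *_) fn≡0) (*-zeroʳ (sgn n))) ⟨
  ∑[ j < n ] (sgn j * f j) + sgn n * f n
    ≡⟨ ∑-sucʳ n (λ j → sgn j * f j) ⟨
  ∑[ i < n ] (1 * f (suc i))
    ≡⟨ ∑-cong n (λ i → *-identityˡ (f (suc i))) ⟩
  ∑[ i < n ] f (suc i)
    ≡⟨ +-identityʳ _ ⟨
  ∑[ i < n ] f (suc i) + 0 ∎)

∑-shift : ∀ n k (f : ℕ → ℕ) → (∀ j → n ≤ j → f j ≡ 0) →
          ∑[ j < n ] (χ (k <? j) * f j) ≡ ∑[ j < n ] (sgn j * f (k + j))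
∑-shift n k f vanish = begin
  ∑ n g                                ≡⟨ ∑-extend n (suc k + n) g (m≤n+m n (suc k)) (λ i n≤i → g-vanish i n≤i) ⟨
  ∑ (suc k + n) g                      ≡⟨ ∑-+ (suc k) n g ⟩
  ∑ (suc k) g + ∑[ i < n ] g (suc k + i) ≡⟨ cong₂ _+_ (∑-vanishing (suc k) g-below) (∑-cong n g-above) ⟩
  ∑[ i < n ] f (suc k + i)             ≡⟨ ∑-cong n (λ i → cong f (sym (+-suc k i))) ⟩
  ∑[ i < n ] f (k + suc i)             ≡⟨ ∑-sgn n (f ∘ (k +_)) (vanish (k + n) (m≤n+m n k)) ⟨
  ∑[ j < n ] (sgn j * f (k + j))       ∎
  where
  g : ℕ → ℕ
  g j = χ (k <? j) * f j
  g-vanish : ∀ j → n ≤ j → g j ≡ 0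
  g-vanish j n≤j = trans (cong (χ (k <? j) *_) (vanish j n≤j)) (*-zeroʳ (χ (k <? j)))
  g-below : ∀ j → j < suc k → g j ≡ 0
  g-below j j<1+k = cong (_* f j) (χ-no (k <? j) (≤⇒≯ (s≤s⁻¹ j<1+k)))
  g-above : ∀ i → g (suc k + i) ≡ f (suc k + i)
  g-above i = trans (cong (_* f (suc k + i)) (χ-yes (k <? suc k + i) (s≤s (m≤m+n k i)))) (+-identityʳ _)

∑-one : ∀ n → ∑[ i < n ] 1 ≡ n
∑-one zero    = refl
∑-one (suc n) = cong suc (∑-one n)

∑-linear : ∀ n → 2 * ∑[ i < n ] suc i ≡ n * suc n
∑-linear zero    = refl
∑-linear (suc n) = begin
  2 * ∑[ i < suc n ] suc i            ≡⟨ cong (2 *_) (∑-sucʳ n suc) ⟩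
  2 * (∑[ i < n ] suc i + suc n)      ≡⟨ *-distribˡ-+ 2 (∑ n suc) (suc n) ⟩
  2 * ∑[ i < n ] suc i + 2 * suc n    ≡⟨ cong (_+ 2 * suc n) (∑-linear n) ⟩
  n * suc n + 2 * suc n               ≡⟨ solve (n ∷ []) ⟩
  suc n * suc (suc n)                 ∎

∑-square : ∀ n → 6 * ∑[ i < n ] (suc i * suc i) ≡ n * suc n * (2 * n + 1)
∑-square zero    = refl
∑-square (suc n) = begin
  6 * ∑[ i < suc n ] sq i                   ≡⟨ cong (6 *_) (∑-sucʳ n sq) ⟩
  6 * (∑[ i < n ] sq i + sq n)              ≡⟨ *-distribˡ-+ 6 (∑ n sq) (sq n) ⟩
  6 * ∑[ i < n ] sq i + 6 * sq n            ≡⟨ cong (_+ 6 * sq n) (∑-square n) ⟩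
  n * suc n * (2 * n + 1) + 6 * (suc n * suc n) ≡⟨ solve (n ∷ []) ⟩
  suc n * suc (suc n) * (2 * suc n + 1)     ∎
  where
  sq : ℕ → ℕ
  sq i = suc i * suc i

∑-even-odd : ∀ n (f : ℕ → ℕ) → ∑ (2 * n) f ≡ ∑[ a < n ] (f (2 * a) + f (suc (2 * a)))
∑-even-odd zero    f = refl
∑-even-odd (suc n) f = begin
  ∑ (2 * suc n) f
    ≡⟨ cong (λ k → ∑ k f) (*-suc 2 n) ⟩
  f 0 + (f 1 + ∑ (2 * n) (f ∘ suc ∘ suc))
    ≡⟨ +-assoc (f 0) (f 1) _ ⟨
  f 0 + f 1 + ∑ (2 * n) (f ∘ suc ∘ suc)
    ≡⟨ cong (f 0 + f 1 +_) (∑-even-odd n (f ∘ suc ∘ suc)) ⟩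
  f 0 + f 1 + ∑[ a < n ] (f (2 + 2 * a) + f (3 + 2 * a))
    ≡⟨ cong (f 0 + f 1 +_) (∑-cong n shift) ⟩
  f 0 + f 1 + ∑[ a < n ] (f (2 * suc a) + f (suc (2 * suc a))) ∎
  where
  shift : ∀ a → f (2 + 2 * a) + f (3 + 2 * a) ≡ f (2 * suc a) + f (suc (2 * suc a))
  shift a rewrite *-suc 2 a = refl

∑-*-∑ : ∀ n m (f g : ℕ → ℕ) → ∑ n f * ∑ m g ≡ ∑[ i < n ] ∑[ j < m ] (f i * g j)
∑-*-∑ n m f g = trans (sym (∑-*ʳ n (∑ m g) f)) (∑-cong n (λ i → sym (∑-*ˡ m (f i) g)))

∑-χ-antidiagonal : ∀ N s t c → ∑[ i < suc N ] (χ (s ≟ i) * (χ (t ≟ N ∸ i) * c)) ≡ χ (s + t ≟ N) * c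
∑-χ-antidiagonal N s t c with s ≤? N
... | yes s≤N = trans (∑-χ-unique (suc N) (s ≟_) (λ i → χ (t ≟ N ∸ i) * c) s (λ _ → sym) refl (s≤s s≤N))
                      (cong (_* c) (χ-cong (t ≟ N ∸ s) (s + t ≟ N) to from))
  where
  to : t ≡ N ∸ s → s + t ≡ N
  to t≡N∸s = trans (cong (s +_) t≡N∸s) (m+[n∸m]≡n s≤N)
  from : s + t ≡ N → t ≡ N ∸ s
  from s+t≡N = trans (sym (m+n∸m≡n s t)) (cong (_∸ s) s+t≡N)
... | no s≰N = trans (∑-χ-none (suc N) (s ≟_) (λ i → χ (t ≟ N ∸ i) * c) s≢i)
                     (sym (cong (_* c) (χ-no (s + t ≟ N) (λ s+t≡N → s≰N (subst (s ≤_) s+t≡N (m≤m+n s t))))))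
  where
  s≢i : ∀ i → i < suc N → s ≢ i
  s≢i i i≤N s≡i = s≰N (subst (_≤ N) (sym s≡i) (s≤s⁻¹ i≤N))

-- The even divisor sum and its convolution

sum-applyUpTo : ∀ (f : ℕ → ℕ) n → sum (applyUpTo f n) ≡ ∑ n f
sum-applyUpTo f zero    = refl
sum-applyUpTo f (suc n) = cong (f 0 +_) (sum-applyUpTo (f ∘ suc) n)

map-applyUpTo : ∀ (f g : ℕ → ℕ) n → map f (applyUpTo g n) ≡ applyUpTo (f ∘ g) n
map-applyUpTo f g zero    = refl
map-applyUpTo f g (suc n) = cong (f (g 0) ∷_) (map-applyUpTo f (g ∘ suc) n)

sum-filter : ∀ {ℓ} {P : Pred ℕ ℓ} (P? : Decidable P) xs → sum (filter P? xs) ≡ sum (map (λ x → χ (P? x) * x) xs)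
sum-filter P? [] = refl
sum-filter P? (x ∷ xs) with P? x
... | yes _ = cong₂ _+_ (sym (+-identityʳ x)) (sum-filter P? xs)
... | no _  = sum-filter P? xs

σeven-∑ : ∀ n → σeven n ≡ ∑[ d < n ] (χ (2 ∣? suc d) * χ (suc d ∣? n) * suc d)
σeven-∑ n = begin
  sum (filter P? (map suc (upTo n)))
    ≡⟨ sum-filter P? (map suc (upTo n)) ⟩
  sum (map term (map suc (upTo n)))
    ≡⟨ cong (sum ∘ map term) (map-applyUpTo suc id n) ⟩
  sum (map term (applyUpTo suc n))
    ≡⟨ cong sum (map-applyUpTo term suc n) ⟩
  sum (applyUpTo (term ∘ suc) n)
    ≡⟨ sum-applyUpTo (term ∘ suc) n ⟩
  ∑[ d < n ] term (suc d)
    ≡⟨ ∑-cong n (λ d → cong (_* suc d) (χ-× (2 ∣? suc d) (suc d ∣? n))) ⟩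
  ∑[ d < n ] (χ (2 ∣? suc d) * χ (suc d ∣? n) * suc d) ∎
  where
  P? = λ d → (2 ∣? d) ×-dec (d ∣? n)
  term : ℕ → ℕ
  term d = χ (P? d) * d

σeven*2-∑ : ∀ N → σeven*2 N ≡ ∑[ i < suc N ] (σeven i * σeven (N ∸ i))
σeven*2-∑ N = begin
  sum (map conv (upTo (suc N)))          ≡⟨ cong sum (map-applyUpTo conv id (suc N)) ⟩
  sum (applyUpTo conv (suc N))           ≡⟨ sum-applyUpTo conv (suc N) ⟩
  ∑[ i < suc N ] conv i                  ∎
  where
  conv : ℕ → ℕ
  conv i = σeven i * σeven (N ∸ i)

∑-χ-divides : ∀ n c i → 1 ≤ c → 1 ≤ i → i < n → ∑[ x < n ] (χ (c * x ≟ i) * sgn x) ≡ χ (c ∣? i)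
∑-χ-divides n c i 1≤c 1≤i i<n with c ∣? i
... | yes (divides q i≡q*c) =
  trans (∑-χ-unique n (λ x → c * x ≟ i) sgn q unique (trans (*-comm c q) (sym i≡q*c)) q<n) (sgn-q q i≡q*c)
  where
  instance
    c≢0 : NonZero c
    c≢0 = >-nonZero 1≤c
  unique : ∀ x → c * x ≡ i → x ≡ q
  unique x c*x≡i = *-cancelˡ-≡ x q c (trans c*x≡i (trans i≡q*c (*-comm q c)))
  q<n : q < n
  q<n = ≤-<-trans (subst (q ≤_) (sym i≡q*c) (m≤m*n q c)) i<n
  sgn-q : ∀ q → i ≡ q * c → sgn q ≡ 1
  sgn-q zero    i≡0 = contradiction i≡0 (>⇒≢ 1≤i)
  sgn-q (suc q) _   = refl
... | no c∤i = ∑-χ-none n (λ x → c * x ≟ i) sgn (λ x _ c*x≡i → c∤i (divides x (trans (sym c*x≡i) (*-comm c x))))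

even∤odd : ∀ a → ¬ (2 ∣ suc (2 * a))
even∤odd a (divides q 1+2a≡q*2) = even≢odd q a (trans (*-comm 2 q) (sym 1+2a≡q*2))

evenDivisorTerm : ℕ → ℕ → ℕ → ℕ
evenDivisorTerm i a x = χ (2 * a * x ≟ i) * sgn x * (2 * a)

σeven-∑∑ : ∀ M i → i < M → σeven i ≡ ∑[ a < M ] ∑[ x < M ] evenDivisorTerm i a x
σeven-∑∑ M zero _ = sym (∑-vanishing M (λ a _ → ∑-vanishing M (λ x _ → term-zero a x)))
  where
  term-zero : ∀ a x → evenDivisorTerm 0 a x ≡ 0
  term-zero zero    x       = *-zeroʳ (χ (2 * 0 * x ≟ 0) * sgn x)
  term-zero (suc a) zero    = cong (_* (2 * suc a)) (*-zeroʳ (χ (2 * suc a * 0 ≟ 0)))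
  term-zero (suc a) (suc x) = cong (λ c → c * 1 * (2 * suc a)) (χ-no (2 * suc a * suc x ≟ 0) λ ())
σeven-∑∑ M (suc i) i<M = begin
  σeven (suc i)
    ≡⟨ σeven-∑ (suc i) ⟩
  ∑[ d < suc i ] h (suc d)
    ≡⟨ cong (_+ ∑[ d < suc i ] h (suc d)) (*-zeroʳ (χ (2 ∣? 0) * χ (0 ∣? suc i))) ⟨
  ∑ (suc (suc i)) h
    ≡⟨ ∑-extend (suc (suc i)) (2 * M) h (≤-trans i<M (m≤n*m M 2)) h-large ⟨
  ∑ (2 * M) h
    ≡⟨ ∑-even-odd M h ⟩
  ∑[ a < M ] (h (2 * a) + h (suc (2 * a)))
    ≡⟨ ∑-cong M h-even-odd ⟩
  ∑[ a < M ] (χ (2 * a ∣? suc i) * (2 * a))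
    ≡⟨ ∑-cong M divisor-count ⟨
  ∑[ a < M ] ∑[ x < M ] evenDivisorTerm (suc i) a x ∎
  where
  h : ℕ → ℕ
  h d = χ (2 ∣? d) * χ (d ∣? suc i) * d
  h-large : ∀ d → suc (suc i) ≤ d → h d ≡ 0
  h-large d 2+i≤d = trans (cong (λ c → χ (2 ∣? d) * c * d) (χ-no (d ∣? suc i) (<⇒≱ 2+i≤d ∘ ∣⇒≤)))
                          (cong (_* d) (*-zeroʳ (χ (2 ∣? d))))
  h-even-odd : ∀ a → h (2 * a) + h (suc (2 * a)) ≡ χ (2 * a ∣? suc i) * (2 * a)
  h-even-odd a rewrite χ-yes (2 ∣? 2 * a) (divides a (*-comm 2 a)) | χ-no (2 ∣? suc (2 * a)) (even∤odd a) =
    trans (+-identityʳ (1 * c * (2 * a))) (cong (_* (2 * a)) (*-identityˡ c))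
    where c = χ (2 * a ∣? suc i)
  divisor-count : ∀ a → ∑[ x < M ] evenDivisorTerm (suc i) a x ≡ χ (2 * a ∣? suc i) * (2 * a)
  divisor-count a = begin
    ∑[ x < M ] (χ (2 * a * x ≟ suc i) * sgn x * (2 * a))   ≡⟨ ∑-*ʳ M (2 * a) _ ⟩
    ∑[ x < M ] (χ (2 * a * x ≟ suc i) * sgn x) * (2 * a)   ≡⟨ count a ⟩
    χ (2 * a ∣? suc i) * (2 * a)                           ∎
    where
    count : ∀ a → ∑[ x < M ] (χ (2 * a * x ≟ suc i) * sgn x) * (2 * a) ≡ χ (2 * a ∣? suc i) * (2 * a)
    count zero    = trans (*-zeroʳ (∑[ x < M ] (χ (0 ≟ suc i) * sgn x))) (sym (*-zeroʳ (χ (0 ∣? suc i))))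
    count (suc a) = cong (_* (2 * suc a)) (∑-χ-divides M (2 * suc a) (suc i) (s≤s z≤n) (s≤s z≤n) i<M)

σeven*2-∑₄ : ∀ N → σeven*2 N ≡
             ∑[ a < suc N ] ∑[ b < suc N ] ∑[ x < suc N ] ∑[ y < suc N ]
               (χ (2 * a * x + 2 * b * y ≟ N) * (sgn x * (2 * a) * (sgn y * (2 * b))))
σeven*2-∑₄ N = begin
  σeven*2 N
    ≡⟨ σeven*2-∑ N ⟩
  ∑[ i < M ] (σeven i * σeven (N ∸ i))
    ≡⟨ ∑-cong< M (λ i i<M → cong₂ _*_ (σeven-∑∑ M i i<M) (σeven-∑∑ M (N ∸ i) (s≤s (m∸n≤m N i)))) ⟩
  ∑[ i < M ] (∑∑ i * ∑∑ (N ∸ i))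
    ≡⟨ ∑-cong M expand ⟩
  ∑[ i < M ] ∑[ a < M ] ∑[ b < M ] ∑[ x < M ] ∑[ y < M ] H i a b x y
    ≡⟨ ∑-comm M M (λ i a → ∑[ b < M ] ∑[ x < M ] ∑[ y < M ] H i a b x y) ⟩
  ∑[ a < M ] ∑[ i < M ] ∑[ b < M ] ∑[ x < M ] ∑[ y < M ] H i a b x y
    ≡⟨ ∑-cong M push-in ⟩
  ∑[ a < M ] ∑[ b < M ] ∑[ x < M ] ∑[ y < M ] ∑[ i < M ] H i a b x y
    ≡⟨ ∑-cong M (λ a → ∑-cong M (λ b → ∑-cong M (λ x → ∑-cong M (collapse a b x)))) ⟩
  ∑[ a < M ] ∑[ b < M ] ∑[ x < M ] ∑[ y < M ]
    (χ (2 * a * x + 2 * b * y ≟ N) * (sgn x * (2 * a) * (sgn y * (2 * b)))) ∎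
  where
  M = suc N
  ∑∑ : ℕ → ℕ
  ∑∑ i = ∑[ a < M ] ∑[ x < M ] evenDivisorTerm i a x
  H : ℕ → ℕ → ℕ → ℕ → ℕ → ℕ
  H i a b x y = evenDivisorTerm i a x * evenDivisorTerm (N ∸ i) b y
  expand : ∀ i → ∑∑ i * ∑∑ (N ∸ i) ≡ ∑[ a < M ] ∑[ b < M ] ∑[ x < M ] ∑[ y < M ] H i a b x y
  expand i = trans (∑-*-∑ M M (λ a → ∑[ x < M ] evenDivisorTerm i a x) (λ b → ∑[ y < M ] evenDivisorTerm (N ∸ i) b y))
                   (∑-cong M (λ a → ∑-cong M (λ b → ∑-*-∑ M M (evenDivisorTerm i a) (evenDivisorTerm (N ∸ i) b))))
  push-in : ∀ a → ∑[ i < M ] ∑[ b < M ] ∑[ x < M ] ∑[ y < M ] H i a b x y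
                ≡ ∑[ b < M ] ∑[ x < M ] ∑[ y < M ] ∑[ i < M ] H i a b x y
  push-in a = trans (∑-comm M M (λ i b → ∑[ x < M ] ∑[ y < M ] H i a b x y)) (∑-cong M (λ b →
              trans (∑-comm M M (λ i x → ∑[ y < M ] H i a b x y)) (∑-cong M (λ x → ∑-comm M M (λ i y → H i a b x y)))))
  reassoc : ∀ u p s v q t → u * p * s * (v * q * t) ≡ u * (v * (p * s * (q * t)))
  reassoc = solve-∀
  collapse : ∀ a b x y → ∑[ i < M ] H i a b x y ≡ χ (2 * a * x + 2 * b * y ≟ N) * (sgn x * (2 * a) * (sgn y * (2 * b)))
  collapse a b x y = trans (∑-cong M (λ i → reassoc (χ (2 * a * x ≟ i)) (sgn x) (2 * a) (χ (2 * b * y ≟ N ∸ i)) (sgn y) (2 * b)))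
                           (∑-χ-antidiagonal N (2 * a * x) (2 * b * y) _)

σeven*2-odd : ∀ K → σeven*2 (suc (2 * K)) ≡ 0
σeven*2-odd K = trans (σeven*2-∑₄ (suc (2 * K)))
  (∑-vanishing M (λ a _ → ∑-vanishing M (λ b _ → ∑-vanishing M (λ x _ → ∑-vanishing M (λ y _ →
    cong (_* (sgn x * (2 * a) * (sgn y * (2 * b))))
         (χ-no (2 * a * x + 2 * b * y ≟ suc (2 * K)) (even≢odd (a * x + b * y) K ∘ trans (double a b x y))))))))
  where
  M = suc (suc (2 * K))
  double : ∀ a b x y → 2 * (a * x + b * y) ≡ 2 * a * x + 2 * b * y
  double = solve-∀

-- Congruences modulo p

∑-cong-% : ∀ p .{{_ : NonZero p}} n (f g : ℕ → ℕ) → (∀ i → i < n → f i % p ≡ g i % p) → ∑ n f % p ≡ ∑ n g % p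
∑-cong-% p zero    f g eq = refl
∑-cong-% p (suc n) f g eq = begin
  (f 0 + ∑ n (f ∘ suc)) % p
    ≡⟨ %-distribˡ-+ (f 0) _ p ⟩
  (f 0 % p + ∑ n (f ∘ suc) % p) % p
    ≡⟨ cong₂ (λ u v → (u + v) % p) (eq 0 z<s) (∑-cong-% p n _ _ (λ i i<n → eq (suc i) (s<s i<n))) ⟩
  (g 0 % p + ∑ n (g ∘ suc) % p) % p
    ≡⟨ %-distribˡ-+ (g 0) _ p ⟨
  (g 0 + ∑ n (g ∘ suc)) % p ∎

∣-cancel-% : ∀ p .{{_ : NonZero p}} x y z → x + y ≡ z → y % p ≡ z % p → p ∣ x
∣-cancel-% p x y z x+y≡z y≡z = ∣m+n∣m⇒∣n (subst (p ∣_) (sym x+[y/p]p≡[z/p]p) (divides (z / p) refl)) (divides (y / p) refl)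
  where
  x+[y/p]p≡[z/p]p : y / p * p + x ≡ z / p * p
  x+[y/p]p≡[z/p]p = +-cancelˡ-≡ (y % p) _ _ (begin
    y % p + (y / p * p + x)   ≡⟨ +-assoc (y % p) _ x ⟨
    y % p + y / p * p + x     ≡⟨ cong (_+ x) (m≡m%n+[m/n]*n y p) ⟨
    y + x                     ≡⟨ trans (+-comm y x) x+y≡z ⟩
    z                         ≡⟨ m≡m%n+[m/n]*n z p ⟩
    z % p + z / p * p         ≡⟨ cong (_+ z / p * p) y≡z ⟨
    y % p + z / p * p         ∎)

infixl 6 _⊕_
infixl 7 _⊗_

data Poly₂ : Set where
  X Y     : Poly₂
  con     : ℕ → Poly₂
  _⊕_ _⊗_ : Poly₂ → Poly₂ → Poly₂

⟦_⟧ : Poly₂ → ℕ → ℕ → ℕ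
⟦ X     ⟧ x y = x
⟦ Y     ⟧ x y = y
⟦ con n ⟧ x y = n
⟦ P ⊕ Q ⟧ x y = ⟦ P ⟧ x y + ⟦ Q ⟧ x y
⟦ P ⊗ Q ⟧ x y = ⟦ P ⟧ x y * ⟦ Q ⟧ x y

⟦⟧-% : ∀ p .{{_ : NonZero p}} P x y → ⟦ P ⟧ x y % p ≡ ⟦ P ⟧ (x % p) (y % p) % p
⟦⟧-% p X       x y = sym (m%n%n≡m%n x p)
⟦⟧-% p Y       x y = sym (m%n%n≡m%n y p)
⟦⟧-% p (con n) x y = refl
⟦⟧-% p (P ⊕ Q) x y = begin
  (⟦ P ⟧ x y + ⟦ Q ⟧ x y) % p
    ≡⟨ %-distribˡ-+ (⟦ P ⟧ x y) _ p ⟩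
  (⟦ P ⟧ x y % p + ⟦ Q ⟧ x y % p) % p
    ≡⟨ cong₂ (λ u v → (u + v) % p) (⟦⟧-% p P x y) (⟦⟧-% p Q x y) ⟩
  (⟦ P ⟧ (x % p) (y % p) % p + ⟦ Q ⟧ (x % p) (y % p) % p) % p
    ≡⟨ %-distribˡ-+ (⟦ P ⟧ (x % p) (y % p)) _ p ⟨
  (⟦ P ⟧ (x % p) (y % p) + ⟦ Q ⟧ (x % p) (y % p)) % p ∎
⟦⟧-% p (P ⊗ Q) x y = begin
  (⟦ P ⟧ x y * ⟦ Q ⟧ x y) % p
    ≡⟨ %-distribˡ-* (⟦ P ⟧ x y) _ p ⟩
  (⟦ P ⟧ x y % p * (⟦ Q ⟧ x y % p)) % p
    ≡⟨ cong₂ (λ u v → (u * v) % p) (⟦⟧-% p P x y) (⟦⟧-% p Q x y) ⟩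
  (⟦ P ⟧ (x % p) (y % p) % p * (⟦ Q ⟧ (x % p) (y % p) % p)) % p
    ≡⟨ %-distribˡ-* (⟦ P ⟧ (x % p) (y % p)) _ p ⟨
  (⟦ P ⟧ (x % p) (y % p) * ⟦ Q ⟧ (x % p) (y % p)) % p ∎

-- Liouville's identity

diagonalTerm compositionTerm : ℕ → ℕ → ℕ
diagonalTerm    (suc d) (suc m) = 6 * (suc d * suc d * m)
diagonalTerm    _       _       = 0
compositionTerm (suc d) (suc m) = m * suc m * (5 * m + 4)
compositionTerm _       _       = 0

-- diagonalTerm, compositionTerm and the product d m, symmetrised and written in d − 1 and m − 1
symDiagonal symComposition product : Poly₂
symDiagonal    = con 6 ⊗ ((X ⊕ con 1) ⊗ (X ⊕ con 1) ⊗ Y) ⊕ con 6 ⊗ ((Y ⊕ con 1) ⊗ (Y ⊕ con 1) ⊗ X)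
symComposition = Y ⊗ (Y ⊕ con 1) ⊗ (con 5 ⊗ Y ⊕ con 4) ⊕ X ⊗ (X ⊕ con 1) ⊗ (con 5 ⊗ X ⊕ con 4)
product        = (X ⊕ con 1) ⊗ (Y ⊕ con 1)

ResidueCondition : (p : ℕ) .{{_ : NonZero p}} → ℕ → Set
ResidueCondition p k = ∀ {r} → r < p → ∀ {s} → s < p →
  ⟦ product ⟧ r s % p ≡ k → ⟦ symDiagonal ⟧ r s % p ≡ ⟦ symComposition ⟧ r s % p

residueCondition? : (p : ℕ) .{{_ : NonZero p}} (k : ℕ) → Dec (ResidueCondition p k)
residueCondition? p k = allUpTo? (λ r → allUpTo? (λ s →
  (⟦ product ⟧ r s % p ≟ k) →-dec (⟦ symDiagonal ⟧ r s % p ≟ ⟦ symComposition ⟧ r s % p)) p) p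

diagonalTerm-sym : ∀ d m → diagonalTerm (suc d) (suc m) + diagonalTerm (suc m) (suc d) ≡ ⟦ symDiagonal ⟧ d m
diagonalTerm-sym = expand
  where
  expand : ∀ d m → 6 * (suc d * suc d * m) + 6 * (suc m * suc m * d) ≡ 6 * ((d + 1) * (d + 1) * m) + 6 * ((m + 1) * (m + 1) * d)
  expand = solve-∀

compositionTerm-sym : ∀ d m → compositionTerm (suc d) (suc m) + compositionTerm (suc m) (suc d) ≡ ⟦ symComposition ⟧ d m
compositionTerm-sym = expand
  where
  expand : ∀ d m → m * suc m * (5 * m + 4) + d * suc d * (5 * d + 4) ≡ m * (m + 1) * (5 * m + 4) + d * (d + 1) * (5 * d + 4)
  expand = solve-∀

product-suc : ∀ d m → suc d * suc m ≡ ⟦ product ⟧ d m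
product-suc = expand
  where
  expand : ∀ d m → suc d * suc m ≡ (d + 1) * (m + 1)
  expand = solve-∀

-- All sums run over [0, M); M > K bounds every variable of a solution of K = a x + b y.
module Liouville (K M : ℕ) (K<M : K < M) where

  ∑₂ : (ℕ → ℕ → ℕ) → ℕ
  ∑₂ f = ∑[ x < M ] ∑[ y < M ] f x y

  ∑₂-cong : ∀ {f g : ℕ → ℕ → ℕ} → (∀ x y → f x y ≡ g x y) → ∑₂ f ≡ ∑₂ g
  ∑₂-cong eq = ∑-cong M (λ x → ∑-cong M (eq x))

  ∑₂-distrib-+ : ∀ (f g : ℕ → ℕ → ℕ) → ∑₂ (λ x y → f x y + g x y) ≡ ∑₂ f + ∑₂ g
  ∑₂-distrib-+ f g = trans (∑-cong M (λ x → ∑-distrib-+ M (f x) (g x))) (∑-distrib-+ M _ _)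

  ∑₂-swap : ∀ (f : ℕ → ℕ → ℕ) → ∑₂ f ≡ ∑₂ (λ x y → f y x)
  ∑₂-swap = ∑-comm M M

  ∑₂-*ˡ : ∀ c (f : ℕ → ℕ → ℕ) → ∑₂ (λ x y → c * f x y) ≡ c * ∑₂ f
  ∑₂-*ˡ c f = trans (∑-cong M (λ x → ∑-*ˡ M c (f x))) (∑-*ˡ M c _)

  ∑₂-zero : ∑₂ (λ _ _ → 0) ≡ 0
  ∑₂-zero = trans (∑-cong M (λ _ → ∑-zero M)) (∑-zero M)

  ∑₂-trichotomy : ∀ (f : ℕ → ℕ → ℕ) →
    ∑₂ f ≡ ∑₂ (λ x y → χ (x <? y) * f x y) + ∑₂ (λ x y → χ (x ≟ y) * f x y) + ∑₂ (λ x y → χ (y <? x) * f x y)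
  ∑₂-trichotomy f = begin
    ∑₂ f                                               ≡⟨ ∑₂-cong (λ x y → split x y) ⟩
    ∑₂ (λ x y → lt x y + eq x y + gt x y)              ≡⟨ ∑₂-distrib-+ (λ x y → lt x y + eq x y) gt ⟩
    ∑₂ (λ x y → lt x y + eq x y) + ∑₂ gt               ≡⟨ cong (_+ ∑₂ gt) (∑₂-distrib-+ lt eq) ⟩
    ∑₂ lt + ∑₂ eq + ∑₂ gt                              ∎
    where
    lt eq gt : ℕ → ℕ → ℕ
    lt x y = χ (x <? y) * f x y
    eq x y = χ (x ≟ y) * f x y
    gt x y = χ (y <? x) * f x y
    distrib : ∀ u v w c → (u + v + w) * c ≡ u * c + v * c + w * c
    distrib = solve-∀
    split : ∀ x y → f x y ≡ lt x y + eq x y + gt x y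
    split x y = begin
      f x y                                              ≡⟨ *-identityˡ (f x y) ⟨
      1 * f x y                                          ≡⟨ cong (_* f x y) (χ-trichotomy x y) ⟨
      (χ (x <? y) + χ (x ≟ y) + χ (y <? x)) * f x y      ≡⟨ distrib (χ (x <? y)) (χ (x ≟ y)) (χ (y <? x)) (f x y) ⟩
      lt x y + eq x y + gt x y                           ∎

  rep : ℕ → ℕ → ℕ → ℕ → ℕ
  rep a b x y = sgn a * (sgn b * (sgn x * (sgn y * χ (a * x + b * y ≟ K))))

  reps reps[x<y] reps[x=y] reps[y<x] : ℕ → ℕ → ℕ
  reps      a b = ∑₂ (rep a b)
  reps[x<y] a b = ∑₂ (λ x y → χ (x <? y) * rep a b x y)
  reps[x=y] a b = ∑₂ (λ x y → χ (x ≟ y) * rep a b x y)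
  reps[y<x] a b = ∑₂ (λ x y → χ (y <? x) * rep a b x y)

  rep-≢ : ∀ a b x y → a * x + b * y ≢ K → rep a b x y ≡ 0
  rep-≢ a b x y ≢K rewrite χ-no (a * x + b * y ≟ K) ≢K
    | *-zeroʳ (sgn y) | *-zeroʳ (sgn x) | *-zeroʳ (sgn b) | *-zeroʳ (sgn a) = refl

  rep-sym : ∀ a b x y → rep a b x y ≡ rep b a y x
  rep-sym a b x y rewrite χ-cong (a * x + b * y ≟ K) (b * y + a * x ≟ K)
                            (trans (+-comm (b * y) (a * x))) (trans (+-comm (a * x) (b * y))) =
    reorder (sgn a) (sgn b) (sgn x) (sgn y) _
    where
    reorder : ∀ p q r s c → p * (q * (r * (s * c))) ≡ q * (p * (s * (r * c)))
    reorder = solve-∀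

  ≢K-beyond : ∀ u v → M ≤ u → u ≤ v → v ≢ K
  ≢K-beyond u v M≤u u≤v refl = <⇒≱ K<M (≤-trans M≤u u≤v)

  rep-large-a : ∀ a b x y → M ≤ a → rep a b x y ≡ 0
  rep-large-a a b zero    y _   rewrite *-zeroʳ (sgn b) | *-zeroʳ (sgn a) = refl
  rep-large-a a b (suc x) y M≤a = rep-≢ a b (suc x) y (≢K-beyond a _ M≤a (≤-trans (m≤m*n a (suc x)) (m≤m+n _ _)))

  rep-large-y : ∀ a b x y → M ≤ y → rep a b x y ≡ 0
  rep-large-y a zero    x y _   rewrite *-zeroʳ (sgn a) = refl
  rep-large-y a (suc b) x y M≤y = rep-≢ a (suc b) x y (≢K-beyond y _ M≤y (≤-trans (m≤n*m y (suc b)) (m≤n+m (suc b * y) (a * x))))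

  reps-sym : ∀ a b → reps a b ≡ reps b a
  reps-sym a b = trans (∑₂-swap _) (∑₂-cong (λ x y → rep-sym a b y x))

  reps[y<x]-sym : ∀ a b → reps[y<x] a b ≡ reps[x<y] b a
  reps[y<x]-sym a b = trans (∑₂-swap _) (∑₂-cong (λ x y → cong (χ (x <? y) *_) (rep-sym a b y x)))

  reps-split : ∀ a b → reps a b ≡ reps[x<y] a b + reps[x=y] a b + reps[y<x] a b
  reps-split a b = ∑₂-trichotomy (rep a b)

  reps-large : ∀ a b → M ≤ a → reps a b ≡ 0
  reps-large a b M≤a = trans (∑₂-cong (λ x y → rep-large-a a b x y M≤a)) ∑₂-zero

  reps[x<y]-zero : ∀ b → reps[x<y] 0 b ≡ 0
  reps[x<y]-zero b = trans (∑₂-cong (λ x y → *-zeroʳ (χ (x <? y)))) ∑₂-zero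

  rep-shift : ∀ a b x y → sgn y * rep (suc a) b x (x + y) ≡ rep (suc a + b) b x y
  rep-shift a zero    x       y       = *-zeroʳ (sgn y)
  rep-shift a (suc b) zero    y       = *-zeroʳ (sgn y)
  rep-shift a (suc b) (suc x) zero    = refl
  rep-shift a (suc b) (suc x) (suc y) = begin
    1 * (1 * (1 * (1 * (1 * χ (suc a * suc x + suc b * (suc x + suc y) ≟ K)))))
      ≡⟨ units _ ⟩
    1 * (1 * (1 * (1 * χ (suc a * suc x + suc b * (suc x + suc y) ≟ K))))
      ≡⟨ cong (λ c → 1 * (1 * (1 * (1 * c)))) (χ-cong (_ ≟ K) (_ ≟ K) (trans (sym shift)) (trans shift)) ⟩
    1 * (1 * (1 * (1 * χ ((suc a + suc b) * suc x + suc b * suc y ≟ K)))) ∎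
    where
    units : ∀ c → 1 * (1 * (1 * (1 * (1 * c)))) ≡ 1 * (1 * (1 * (1 * c)))
    units = solve-∀
    regroup : ∀ a b x y → a * x + b * (x + y) ≡ (a + b) * x + b * y
    regroup = solve-∀
    shift = regroup (suc a) (suc b) (suc x) (suc y)

  reps[x<y]-shift : ∀ a b → reps[x<y] (suc a) b ≡ reps (suc a + b) b
  reps[x<y]-shift a b = ∑-cong M (λ x →
    trans (∑-shift M x (rep (suc a) b x) (rep-large-y (suc a) b x)) (∑-cong M (rep-shift a b x)))

  ∑₂-below-diagonal : ∀ (g : ℕ → ℕ → ℕ) →
    ∑₂ (λ a b → χ (b <? a) * (g a b * reps a b)) ≡ ∑₂ (λ a b → g (a + b) b * reps[x<y] a b)
  ∑₂-below-diagonal g = begin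
    ∑₂ (λ a b → χ (b <? a) * (g a b * reps a b))
      ≡⟨ ∑₂-swap _ ⟩
    ∑₂ (λ b a → χ (b <? a) * (g a b * reps a b))
      ≡⟨ ∑-cong M (λ b → ∑-shift M b (λ a → g a b * reps a b) (λ a M≤a → vanish a b M≤a)) ⟩
    ∑₂ (λ b a → sgn a * (g (b + a) b * reps (b + a) b))
      ≡⟨ ∑₂-cong (λ b a → shifted a b) ⟩
    ∑₂ (λ b a → g (a + b) b * reps[x<y] a b)
      ≡⟨ ∑₂-swap _ ⟨
    ∑₂ (λ a b → g (a + b) b * reps[x<y] a b) ∎
    where
    vanish : ∀ a b → M ≤ a → g a b * reps a b ≡ 0
    vanish a b M≤a = trans (cong (g a b *_) (reps-large a b M≤a)) (*-zeroʳ (g a b))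
    shifted : ∀ a b → sgn a * (g (b + a) b * reps (b + a) b) ≡ g (a + b) b * reps[x<y] a b
    shifted zero    b rewrite reps[x<y]-zero b | *-zeroʳ (g b b) = refl
    shifted (suc a) b rewrite reps[x<y]-shift a b | +-comm b (suc a) = +-identityʳ _

  ∑₂-reps-split-xy : ∀ (g : ℕ → ℕ → ℕ) → ∑₂ (λ a b → g a b * reps a b) ≡
    ∑₂ (λ a b → g a b * reps[x<y] a b) + ∑₂ (λ a b → g a b * reps[x=y] a b) + ∑₂ (λ a b → g b a * reps[x<y] a b)
  ∑₂-reps-split-xy g = begin
    ∑₂ (λ a b → g a b * reps a b)
      ≡⟨ ∑₂-cong (λ a b → trans (cong (g a b *_) (reps-split a b)) (distrib (g a b) _ _ _)) ⟩
    ∑₂ (λ a b → g a b * reps[x<y] a b + g a b * reps[x=y] a b + g a b * reps[y<x] a b)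
      ≡⟨ ∑₂-distrib-+ _ _ ⟩
    ∑₂ (λ a b → g a b * reps[x<y] a b + g a b * reps[x=y] a b) + ∑₂ (λ a b → g a b * reps[y<x] a b)
      ≡⟨ cong₂ _+_ (∑₂-distrib-+ _ _) (trans (∑₂-cong (λ a b → cong (g a b *_) (reps[y<x]-sym a b))) (∑₂-swap _)) ⟩
    ∑₂ (λ a b → g a b * reps[x<y] a b) + ∑₂ (λ a b → g a b * reps[x=y] a b) + ∑₂ (λ a b → g b a * reps[x<y] a b) ∎
    where
    distrib : ∀ c u v w → c * (u + v + w) ≡ c * u + c * v + c * w
    distrib = solve-∀

  ∑₂-reps-split-ab : ∀ (g : ℕ → ℕ → ℕ) → ∑₂ (λ a b → g a b * reps a b) ≡
    ∑₂ (λ a b → χ (b <? a) * (g b a * reps a b)) + ∑₂ (λ a b → χ (a ≟ b) * (g a b * reps a b))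
      + ∑₂ (λ a b → χ (b <? a) * (g a b * reps a b))
  ∑₂-reps-split-ab g = trans (∑₂-trichotomy (λ a b → g a b * reps a b))
    (cong (λ s → s + ∑₂ (λ a b → χ (a ≟ b) * (g a b * reps a b)) + ∑₂ (λ a b → χ (b <? a) * (g a b * reps a b))) upper-to-lower)
    where
    upper-to-lower : ∑₂ (λ a b → χ (a <? b) * (g a b * reps a b)) ≡ ∑₂ (λ a b → χ (b <? a) * (g b a * reps a b))
    upper-to-lower = trans (∑₂-swap _) (∑₂-cong (λ a b → cong (λ n → χ (b <? a) * (g b a * n)) (reps-sym b a)))

  -- Sab = ∑_{u+v=K} σ(u) σ(v), as reps a b counts the ways to write K = a x + b y.
  Sab Saa Saa[b<a] Sbb[b<a] Sab[b<a] Saa[x<y] Sbb[x<y] Sab[x<y] Saa[a=b] Saa[x=y] Sab[x=y] : ℕ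
  Sab      = ∑₂ (λ a b → a * b * reps a b)
  Saa      = ∑₂ (λ a b → a * a * reps a b)
  Saa[b<a] = ∑₂ (λ a b → χ (b <? a) * (a * a * reps a b))
  Sbb[b<a] = ∑₂ (λ a b → χ (b <? a) * (b * b * reps a b))
  Sab[b<a] = ∑₂ (λ a b → χ (b <? a) * (a * b * reps a b))
  Saa[x<y] = ∑₂ (λ a b → a * a * reps[x<y] a b)
  Sbb[x<y] = ∑₂ (λ a b → b * b * reps[x<y] a b)
  Sab[x<y] = ∑₂ (λ a b → a * b * reps[x<y] a b)
  Saa[a=b] = ∑₂ (λ a b → χ (a ≟ b) * (a * a * reps a b))
  Saa[x=y] = ∑₂ (λ a b → a * a * reps[x=y] a b)
  Sab[x=y] = ∑₂ (λ a b → a * b * reps[x=y] a b)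

  Saa[b<a]-shift : Saa[b<a] ≡ Saa[x<y] + (Sab[x<y] + Sab[x<y]) + Sbb[x<y]
  Saa[b<a]-shift = trans (∑₂-below-diagonal (λ a b → a * a))
    (trans (∑₂-cong (λ a b → square a b (reps[x<y] a b)))
    (trans (∑₂-distrib-+ _ _) (cong (_+ Sbb[x<y]) (trans (∑₂-distrib-+ _ _) (cong (Saa[x<y] +_) (∑₂-distrib-+ _ _))))))
    where
    square : ∀ a b n → (a + b) * (a + b) * n ≡ a * a * n + (a * b * n + a * b * n) + b * b * n
    square = solve-∀

  Sbb[b<a]-shift : Sbb[b<a] ≡ Sbb[x<y]
  Sbb[b<a]-shift = ∑₂-below-diagonal (λ a b → b * b)

  Sab[b<a]-shift : Sab[b<a] ≡ Sab[x<y] + Sbb[x<y]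
  Sab[b<a]-shift = trans (∑₂-below-diagonal (λ a b → a * b))
                         (trans (∑₂-cong (λ a b → distrib a b (reps[x<y] a b))) (∑₂-distrib-+ _ _))
    where
    distrib : ∀ a b n → (a + b) * b * n ≡ a * b * n + b * b * n
    distrib = solve-∀

  Saa-split-xy : Saa ≡ Saa[x<y] + Saa[x=y] + Sbb[x<y]
  Saa-split-xy = ∑₂-reps-split-xy (λ a b → a * a)

  Saa-split-ab : Saa ≡ Sbb[b<a] + Saa[a=b] + Saa[b<a]
  Saa-split-ab = ∑₂-reps-split-ab (λ a b → a * a)

  Sab-split-xy : Sab ≡ Sab[x<y] + Sab[x=y] + Sab[x<y]
  Sab-split-xy = trans (∑₂-reps-split-xy (λ a b → a * b))
    (cong (Sab[x<y] + Sab[x=y] +_) (∑₂-cong (λ a b → cong (_* reps[x<y] a b) (*-comm b a))))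

  Sab-split-ab : Sab ≡ Sab[b<a] + Saa[a=b] + Sab[b<a]
  Sab-split-ab = trans (∑₂-reps-split-ab (λ a b → a * b))
    (cong₂ (λ s t → s + t + Sab[b<a])
           (∑₂-cong (λ a b → cong (λ c → χ (b <? a) * (c * reps a b)) (*-comm b a)))
           (∑₂-cong diagonal))
    where
    diagonal : ∀ a b → χ (a ≟ b) * (a * b * reps a b) ≡ χ (a ≟ b) * (a * a * reps a b)
    diagonal a b with a ≟ b
    ... | yes refl = refl
    ... | no _     = refl

  Saa-via-x<y : Saa ≡ Sbb[x<y] + Saa[a=b] + (Saa[x<y] + (Sab[x<y] + Sab[x<y]) + Sbb[x<y])
  Saa-via-x<y = trans Saa-split-ab (cong₂ (λ u v → u + Saa[a=b] + v) Sbb[b<a]-shift Saa[b<a]-shift)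

  Sab-via-x<y : Sab ≡ Sab[x<y] + Sbb[x<y] + Saa[a=b] + (Sab[x<y] + Sbb[x<y])
  Sab-via-x<y = trans Sab-split-ab (cong₂ (λ u v → u + Saa[a=b] + v) Sab[b<a]-shift Sab[b<a]-shift)

  Sab-identity : Sab + Sab + Saa[a=b] ≡ Saa[x=y] + Saa[x=y] + Sab[x=y]
  Sab-identity = +-cancelʳ-≡ excess _ _ (begin
    Sab + Sab + Saa[a=b] + excess
      ≡⟨ cong (λ s → s + s + Saa[a=b] + excess) Sab-via-x<y ⟩
    sab + sab + Saa[a=b] + excess
      ≡⟨ regroup₁ Saa[x<y] Sbb[x<y] Sab[x<y] Saa[a=b] ⟩
    saa + saa + sab
      ≡⟨ cong₂ (λ t s → t + t + s) Saa-via-x<y Sab-via-x<y ⟨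
    Saa + Saa + Sab
      ≡⟨ cong₂ (λ t s → t + t + s) Saa-split-xy Sab-split-xy ⟩
    (Saa[x<y] + Saa[x=y] + Sbb[x<y]) + (Saa[x<y] + Saa[x=y] + Sbb[x<y]) + (Sab[x<y] + Sab[x=y] + Sab[x<y])
      ≡⟨ regroup₂ Saa[x<y] Sbb[x<y] Sab[x<y] Saa[x=y] Sab[x=y] ⟩
    Saa[x=y] + Saa[x=y] + Sab[x=y] + excess ∎)
    where
    excess saa sab : ℕ
    excess = Saa[x<y] + Saa[x<y] + (Sbb[x<y] + Sbb[x<y]) + (Sab[x<y] + Sab[x<y])
    saa = Sbb[x<y] + Saa[a=b] + (Saa[x<y] + (Sab[x<y] + Sab[x<y]) + Sbb[x<y])
    sab = Sab[x<y] + Sbb[x<y] + Saa[a=b] + (Sab[x<y] + Sbb[x<y])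
    regroup₁ : ∀ r₁ r₂ r₃ d → (r₃ + r₂ + d + (r₃ + r₂)) + (r₃ + r₂ + d + (r₃ + r₂)) + d + (r₁ + r₁ + (r₂ + r₂) + (r₃ + r₃))
                              ≡ (r₂ + d + (r₁ + (r₃ + r₃) + r₂)) + (r₂ + d + (r₁ + (r₃ + r₃) + r₂)) + (r₃ + r₂ + d + (r₃ + r₂))
    regroup₁ = solve-∀
    regroup₂ : ∀ r₁ r₂ r₃ e f → (r₁ + e + r₂) + (r₁ + e + r₂) + (r₃ + f + r₃) ≡ e + e + f + (r₁ + r₁ + (r₂ + r₂) + (r₃ + r₃))
    regroup₂ = solve-∀

  ∑-χ-point : ∀ s (h : ℕ → ℕ) → (M ≤ s → h s ≡ 0) → ∑[ m < M ] (χ (s ≟ m) * h m) ≡ h s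
  ∑-χ-point s h vanish with s <? M
  ... | yes s<M = ∑-χ-unique M (s ≟_) h s (λ _ → sym) refl s<M
  ... | no  s≮M = trans (∑-χ-none M (s ≟_) h (λ i i<M s≡i → s≮M (subst (_< M) (sym s≡i) i<M))) (sym (vanish (≮⇒≥ s≮M)))

  ∑₂-∑-comm : ∀ (f : ℕ → ℕ → ℕ → ℕ) → ∑₂ (λ x y → ∑[ m < M ] f x y m) ≡ ∑[ m < M ] ∑₂ (λ x y → f x y m)
  ∑₂-∑-comm f = trans (∑-cong M (λ x → ∑-comm M M (f x))) (∑-comm M M _)

  ∑₂-χ-factor : ∀ c (g : ℕ → ℕ → ℕ) → ∑₂ (λ x y → χ (suc c * (x + y) ≟ K) * g x y)
                                      ≡ ∑[ m < M ] (χ (suc c * m ≟ K) * ∑₂ (λ x y → χ (x + y ≟ m) * g x y))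
  ∑₂-χ-factor c g = begin
    ∑₂ (λ x y → χ (suc c * (x + y) ≟ K) * g x y)
      ≡⟨ ∑₂-cong (λ x y → sym (∑-χ-point (x + y) (h x y) (beyond x y))) ⟩
    ∑₂ (λ x y → ∑[ m < M ] (χ (x + y ≟ m) * h x y m))
      ≡⟨ ∑₂-∑-comm (λ x y m → χ (x + y ≟ m) * h x y m) ⟩
    ∑[ m < M ] ∑₂ (λ x y → χ (x + y ≟ m) * h x y m)
      ≡⟨ ∑-cong M (λ m → ∑₂-cong (λ x y → x∙yz≈y∙xz (χ (x + y ≟ m)) (χ (suc c * m ≟ K)) (g x y))) ⟩
    ∑[ m < M ] ∑₂ (λ x y → χ (suc c * m ≟ K) * (χ (x + y ≟ m) * g x y))
      ≡⟨ ∑-cong M (λ m → ∑₂-*ˡ (χ (suc c * m ≟ K)) (λ x y → χ (x + y ≟ m) * g x y)) ⟩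
    ∑[ m < M ] (χ (suc c * m ≟ K) * ∑₂ (λ x y → χ (x + y ≟ m) * g x y)) ∎
    where
    h : ℕ → ℕ → ℕ → ℕ
    h x y m = χ (suc c * m ≟ K) * g x y
    beyond : ∀ x y → M ≤ x + y → h x y (x + y) ≡ 0
    beyond x y M≤x+y = cong (_* g x y) (χ-no (_ ≟ K) (≢K-beyond (x + y) _ M≤x+y (m≤n*m (x + y) (suc c))))

  ∑dm≡K : (ℕ → ℕ → ℕ) → ℕ
  ∑dm≡K F = ∑₂ (λ d m → χ (d * m ≟ K) * F d m)

  ∑compositions : (ℕ → ℕ → ℕ) → ℕ → ℕ
  ∑compositions h n = ∑₂ (λ x y → χ (x + y ≟ n) * (sgn x * (sgn y * h x y)))

  Saa[a=b]-eval : Saa[a=b] ≡ ∑dm≡K (λ d m → d * d * ∑compositions (λ _ _ → 1) m)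
  Saa[a=b]-eval = ∑-cong< M (λ a a<M → trans (∑-χ-unique M (a ≟_) (λ b → a * a * reps a b) a (λ _ → sym) refl a<M) (diagonal a))
    where
    diagonal : ∀ a → a * a * reps a a ≡ ∑[ m < M ] (χ (a * m ≟ K) * (a * a * ∑compositions (λ _ _ → 1) m))
    diagonal zero    = sym (∑-vanishing M (λ m _ → *-zeroʳ (χ (0 * m ≟ K))))
    diagonal (suc a) = begin
      a² * reps (suc a) (suc a)
        ≡⟨ cong (a² *_) (∑₂-cong rep-diagonal) ⟩
      a² * ∑₂ (λ x y → χ (suc a * (x + y) ≟ K) * (sgn x * (sgn y * 1)))
        ≡⟨ cong (a² *_) (∑₂-χ-factor a _) ⟩
      a² * ∑[ m < M ] (χ (suc a * m ≟ K) * ∑compositions (λ _ _ → 1) m)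
        ≡⟨ ∑-*ˡ M a² _ ⟨
      ∑[ m < M ] (a² * (χ (suc a * m ≟ K) * ∑compositions (λ _ _ → 1) m))
        ≡⟨ ∑-cong M (λ m → x∙yz≈y∙xz a² (χ (suc a * m ≟ K)) _) ⟩
      ∑[ m < M ] (χ (suc a * m ≟ K) * (a² * ∑compositions (λ _ _ → 1) m)) ∎
      where
      a² = suc a * suc a
      reorder : ∀ p q c → 1 * (1 * (p * (q * c))) ≡ c * (p * (q * 1))
      reorder = solve-∀
      rep-diagonal : ∀ x y → rep (suc a) (suc a) x y ≡ χ (suc a * (x + y) ≟ K) * (sgn x * (sgn y * 1))
      rep-diagonal x y rewrite χ-cong (suc a * x + suc a * y ≟ K) (suc a * (x + y) ≟ K)
                                 (trans (*-distribˡ-+ (suc a) x y)) (trans (sym (*-distribˡ-+ (suc a) x y))) =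
        reorder (sgn x) (sgn y) _

  w : ℕ → ℕ → ℕ
  w a b = a * a + a * a + a * b

  Sw-eval : Saa[x=y] + Saa[x=y] + Sab[x=y] ≡ ∑dm≡K (λ d m → sgn d * ∑compositions w m)
  Sw-eval = begin
    Saa[x=y] + Saa[x=y] + Sab[x=y]                         ≡⟨ collect ⟨
    ∑₂ (λ a b → w a b * reps[x=y] a b)                     ≡⟨ ∑₂-cong (λ a b → cong (w a b *_) (on-diagonal a b)) ⟩
    ∑₂ (λ a b → w a b * ∑[ x < M ] rep a b x x)            ≡⟨ ∑₂-cong (λ a b → sym (∑-*ˡ M (w a b) _)) ⟩
    ∑₂ (λ a b → ∑[ x < M ] (w a b * rep a b x x))          ≡⟨ ∑₂-∑-comm _ ⟩
    ∑[ x < M ] ∑₂ (λ a b → w a b * rep a b x x)            ≡⟨ ∑-cong M factor ⟩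
    ∑dm≡K (λ d m → sgn d * ∑compositions w m)              ∎
    where
    distrib : ∀ u v n → (u + u + v) * n ≡ u * n + u * n + v * n
    distrib = solve-∀
    collect : ∑₂ (λ a b → w a b * reps[x=y] a b) ≡ Saa[x=y] + Saa[x=y] + Sab[x=y]
    collect = trans (∑₂-cong (λ a b → distrib (a * a) (a * b) (reps[x=y] a b)))
                    (trans (∑₂-distrib-+ _ _) (cong (_+ Sab[x=y]) (∑₂-distrib-+ _ _)))
    on-diagonal : ∀ a b → reps[x=y] a b ≡ ∑[ x < M ] rep a b x x
    on-diagonal a b = ∑-cong< M (λ x x<M → ∑-χ-unique M (x ≟_) (rep a b x) x (λ _ → sym) refl x<M)
    reorder : ∀ c p q u → c * (p * (q * (1 * (1 * u)))) ≡ u * (p * (q * c))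
    reorder = solve-∀
    regroup : ∀ x a b → x * (a + b) ≡ a * x + b * x
    regroup = solve-∀
    rep-on-diagonal : ∀ x a b → w a b * rep a b (suc x) (suc x) ≡ χ (suc x * (a + b) ≟ K) * (sgn a * (sgn b * w a b))
    rep-on-diagonal x a b rewrite χ-cong (a * suc x + b * suc x ≟ K) (suc x * (a + b) ≟ K)
                                    (trans (regroup (suc x) a b)) (trans (sym (regroup (suc x) a b))) =
      reorder (w a b) (sgn a) (sgn b) _
    factor : ∀ x → ∑₂ (λ a b → w a b * rep a b x x) ≡ ∑[ m < M ] (χ (x * m ≟ K) * (sgn x * ∑compositions w m))
    factor zero = trans (∑₂-cong zero-term) (trans ∑₂-zero (sym (∑-vanishing M (λ m _ → *-zeroʳ (χ (0 * m ≟ K))))))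
      where
      zero-term : ∀ a b → w a b * rep a b 0 0 ≡ 0
      zero-term a b rewrite *-zeroʳ (sgn b) | *-zeroʳ (sgn a) = *-zeroʳ (w a b)
    factor (suc x) = begin
      ∑₂ (λ a b → w a b * rep a b (suc x) (suc x))
        ≡⟨ ∑₂-cong (rep-on-diagonal x) ⟩
      ∑₂ (λ a b → χ (suc x * (a + b) ≟ K) * (sgn a * (sgn b * w a b)))
        ≡⟨ ∑₂-χ-factor x _ ⟩
      ∑[ m < M ] (χ (suc x * m ≟ K) * ∑compositions w m)
        ≡⟨ ∑-cong M (λ m → cong (χ (suc x * m ≟ K) *_) (*-identityˡ _)) ⟨
      ∑[ m < M ] (χ (suc x * m ≟ K) * (1 * ∑compositions w m)) ∎

  ∑₂-antidiagonal : ∀ (F : ℕ → ℕ → ℕ) n → n < M → ∑₂ (λ x y → χ (x + y ≟ n) * F x y) ≡ ∑[ x < suc n ] F x (n ∸ x)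
  ∑₂-antidiagonal F n n<M = begin
    ∑[ x < M ] row x            ≡⟨ ∑-extend (suc n) M row n<M row-beyond ⟩
    ∑[ x < suc n ] row x        ≡⟨ ∑-cong< (suc n) row-within ⟩
    ∑[ x < suc n ] F x (n ∸ x)  ∎
    where
    row : ℕ → ℕ
    row x = ∑[ y < M ] (χ (x + y ≟ n) * F x y)
    row-beyond : ∀ x → suc n ≤ x → row x ≡ 0
    row-beyond x n<x = ∑-χ-none M (λ y → x + y ≟ n) (F x) (λ y _ x+y≡n → <⇒≱ n<x (subst (x ≤_) x+y≡n (m≤m+n x y)))
    row-within : ∀ x → x < suc n → row x ≡ F x (n ∸ x)
    row-within x x≤n = ∑-χ-unique M (λ y → x + y ≟ n) (F x) (n ∸ x)
      (λ y x+y≡n → trans (sym (m+n∸m≡n x y)) (cong (_∸ x) x+y≡n)) (m+[n∸m]≡n (s≤s⁻¹ x≤n)) (≤-<-trans (m∸n≤m n x) n<M)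

  ∑compositions-suc : ∀ (h : ℕ → ℕ → ℕ) m → suc m < M → ∑compositions h (suc m) ≡ ∑[ i < m ] h (suc i) (m ∸ i)
  ∑compositions-suc h m 1+m<M = begin
    ∑compositions h (suc m)                                   ≡⟨ ∑₂-antidiagonal _ (suc m) 1+m<M ⟩
    ∑[ i < suc m ] (1 * (sgn (m ∸ i) * h (suc i) (m ∸ i)))    ≡⟨ ∑-extend m (suc m) _ (n≤1+n m) beyond ⟩
    ∑[ i < m ] (1 * (sgn (m ∸ i) * h (suc i) (m ∸ i)))        ≡⟨ ∑-cong< m within ⟩
    ∑[ i < m ] h (suc i) (m ∸ i)                              ∎
    where
    beyond : ∀ i → m ≤ i → 1 * (sgn (m ∸ i) * h (suc i) (m ∸ i)) ≡ 0
    beyond i m≤i rewrite m≤n⇒m∸n≡0 m≤i = refl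
    within : ∀ i → i < m → 1 * (sgn (m ∸ i) * h (suc i) (m ∸ i)) ≡ h (suc i) (m ∸ i)
    within i i<m rewrite sgn-∸ i<m = trans (*-identityˡ _) (*-identityˡ _)

  ∑compositions-one : ∀ m → suc m < M → ∑compositions (λ _ _ → 1) (suc m) ≡ m
  ∑compositions-one m 1+m<M = trans (∑compositions-suc (λ _ _ → 1) m 1+m<M) (∑-one m)

  ∑compositions-w : ∀ m → suc m < M → 6 * ∑compositions w (suc m) ≡ m * suc m * (5 * m + 4)
  ∑compositions-w m 1+m<M = begin
    6 * ∑compositions w (suc m)
      ≡⟨ cong (6 *_) (∑compositions-suc w m 1+m<M) ⟩
    6 * ∑[ i < m ] w (suc i) (m ∸ i)
      ≡⟨ cong (6 *_) (∑-cong< m w-term) ⟩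
    6 * ∑[ i < m ] (suc i * suc i + suc m * suc i)
      ≡⟨ cong (6 *_) (∑-distrib-+ m _ _) ⟩
    6 * (∑[ i < m ] (suc i * suc i) + ∑[ i < m ] (suc m * suc i))
      ≡⟨ cong (λ s → 6 * (∑[ i < m ] (suc i * suc i) + s)) (∑-*ˡ m (suc m) suc) ⟩
    6 * (∑[ i < m ] (suc i * suc i) + suc m * ∑[ i < m ] suc i)
      ≡⟨ rearrange (∑[ i < m ] (suc i * suc i)) (∑ m suc) m ⟩
    6 * ∑[ i < m ] (suc i * suc i) + 3 * (suc m * (2 * ∑[ i < m ] suc i))
      ≡⟨ cong₂ (λ s t → s + 3 * (suc m * t)) (∑-square m) (∑-linear m) ⟩
    m * suc m * (2 * m + 1) + 3 * (suc m * (m * suc m))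
      ≡⟨ solve (m ∷ []) ⟩
    m * suc m * (5 * m + 4) ∎
    where
    rearrange : ∀ s t m → 6 * (s + suc m * t) ≡ 6 * s + 3 * (suc m * (2 * t))
    rearrange = solve-∀
    expand : ∀ i t → suc i * suc i + suc i * suc i + suc i * t ≡ suc i * suc i + suc (t + i) * suc i
    expand = solve-∀
    w-term : ∀ i → i < m → w (suc i) (m ∸ i) ≡ suc i * suc i + suc m * suc i
    w-term i i<m = trans (expand i (m ∸ i)) (cong (λ k → suc i * suc i + suc k * suc i) (m∸n+n≡m (<⇒≤ i<m)))

  ∑dm≡K-cong : ∀ {F G : ℕ → ℕ → ℕ} → (∀ d m → d * m ≡ K → F d m ≡ G d m) → ∑dm≡K F ≡ ∑dm≡K G
  ∑dm≡K-cong {F} {G} eq = ∑₂-cong on-factorisations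
    where
    on-factorisations : ∀ d m → χ (d * m ≟ K) * F d m ≡ χ (d * m ≟ K) * G d m
    on-factorisations d m with d * m ≟ K
    ... | yes dm≡K = cong (1 *_) (eq d m dm≡K)
    ... | no _     = refl

  ∑dm≡K-cong-% : ∀ p .{{_ : NonZero p}} {F G : ℕ → ℕ → ℕ} →
                 (∀ d m → d * m ≡ K → F d m % p ≡ G d m % p) → ∑dm≡K F % p ≡ ∑dm≡K G % p
  ∑dm≡K-cong-% p {F} {G} eq = ∑-cong-% p M _ _ (λ d _ → ∑-cong-% p M _ _ (λ m _ → on-factorisations d m))
    where
    on-factorisations : ∀ d m → (χ (d * m ≟ K) * F d m) % p ≡ (χ (d * m ≟ K) * G d m) % p
    on-factorisations d m with d * m ≟ K
    ... | yes dm≡K = trans (cong (_% p) (*-identityˡ (F d m)))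
                           (trans (eq d m dm≡K) (cong (_% p) (sym (*-identityˡ (G d m)))))
    ... | no _     = refl

  ∑dm≡K-*ˡ : ∀ c F → c * ∑dm≡K F ≡ ∑dm≡K (λ d m → c * F d m)
  ∑dm≡K-*ˡ c F = trans (sym (∑₂-*ˡ c _)) (∑₂-cong (λ d m → x∙yz≈y∙xz c (χ (d * m ≟ K)) (F d m)))

  ∑dm≡K-transpose : ∀ F → ∑dm≡K F ≡ ∑dm≡K (λ d m → F m d)
  ∑dm≡K-transpose F = trans (∑₂-swap _) (∑₂-cong (λ d m → cong (_* F m d) (χ-cong (m * d ≟ K) (d * m ≟ K) (trans (*-comm d m))
                                                                                                (trans (*-comm m d)))))

  ∑dm≡K-distrib-+ : ∀ F G → ∑dm≡K (λ d m → F d m + G d m) ≡ ∑dm≡K F + ∑dm≡K G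
  ∑dm≡K-distrib-+ F G = trans (∑₂-cong (λ d m → *-distribˡ-+ (χ (d * m ≟ K)) (F d m) (G d m))) (∑₂-distrib-+ _ _)

  ∑dm≡K-symmetrise : ∀ F → ∑dm≡K (λ d m → F d m + F m d) ≡ ∑dm≡K F + ∑dm≡K F
  ∑dm≡K-symmetrise F = trans (∑dm≡K-distrib-+ F _) (cong (∑dm≡K F +_) (sym (∑dm≡K-transpose F)))

  module _ (1≤K : 1 ≤ K) where

    factors-suc : ∀ d m → d * m ≡ K → ∃ λ d′ → ∃ λ m′ → d ≡ suc d′ × m ≡ suc m′
    factors-suc zero    m       dm≡K = contradiction (sym dm≡K) (>⇒≢ 1≤K)
    factors-suc (suc d) zero    dm≡K = contradiction (trans (sym dm≡K) (*-zeroʳ (suc d))) (>⇒≢ 1≤K)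
    factors-suc (suc d) (suc m) _    = d , m , refl , refl

    cofactor<M : ∀ d m → suc d * suc m ≡ K → suc m < M
    cofactor<M d m dm≡K = <-≤-trans (s≤s (subst (suc m ≤_) dm≡K (m≤n*m (suc m) (suc d)))) K<M

    6Saa[a=b] : 6 * Saa[a=b] ≡ ∑dm≡K diagonalTerm
    6Saa[a=b] = trans (cong (6 *_) Saa[a=b]-eval) (trans (∑dm≡K-*ˡ 6 _) (∑dm≡K-cong term))
      where
      term : ∀ d m → d * m ≡ K → 6 * (d * d * ∑compositions (λ _ _ → 1) m) ≡ diagonalTerm d m
      term d m dm≡K with factors-suc d m dm≡K
      ... | d′ , m′ , refl , refl = cong (λ c → 6 * (suc d′ * suc d′ * c)) (∑compositions-one m′ (cofactor<M d′ m′ dm≡K))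

    6Sw : 6 * (Saa[x=y] + Saa[x=y] + Sab[x=y]) ≡ ∑dm≡K compositionTerm
    6Sw = trans (cong (6 *_) Sw-eval) (trans (∑dm≡K-*ˡ 6 _) (∑dm≡K-cong term))
      where
      term : ∀ d m → d * m ≡ K → 6 * (sgn d * ∑compositions w m) ≡ compositionTerm d m
      term d m dm≡K with factors-suc d m dm≡K
      ... | d′ , m′ , refl , refl = trans (cong (6 *_) (*-identityˡ (∑compositions w (suc m′))))
                                          (∑compositions-w m′ (cofactor<M d′ m′ dm≡K))

    liouville-identity : 24 * Sab + ∑dm≡K (λ d m → diagonalTerm d m + diagonalTerm m d)
                       ≡ ∑dm≡K (λ d m → compositionTerm d m + compositionTerm m d)
    liouville-identity = begin
      24 * Sab + ∑dm≡K (λ d m → diagonalTerm d m + diagonalTerm m d)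
        ≡⟨ cong (24 * Sab +_) (∑dm≡K-symmetrise diagonalTerm) ⟩
      24 * Sab + (∑dm≡K diagonalTerm + ∑dm≡K diagonalTerm)
        ≡⟨ cong (λ t → 24 * Sab + (t + t)) 6Saa[a=b] ⟨
      24 * Sab + (6 * Saa[a=b] + 6 * Saa[a=b])
        ≡⟨ regroup Sab Saa[a=b] ⟩
      6 * (Sab + Sab + Saa[a=b]) + 6 * (Sab + Sab + Saa[a=b])
        ≡⟨ cong (λ t → 6 * t + 6 * t) Sab-identity ⟩
      6 * (Saa[x=y] + Saa[x=y] + Sab[x=y]) + 6 * (Saa[x=y] + Saa[x=y] + Sab[x=y])
        ≡⟨ cong (λ t → t + t) 6Sw ⟩
      ∑dm≡K compositionTerm + ∑dm≡K compositionTerm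
        ≡⟨ ∑dm≡K-symmetrise compositionTerm ⟨
      ∑dm≡K (λ d m → compositionTerm d m + compositionTerm m d) ∎
      where
      regroup : ∀ s a → 24 * s + (6 * a + 6 * a) ≡ 6 * (s + s + a) + 6 * (s + s + a)
      regroup = solve-∀

    24Sab-divisible : ∀ p .{{_ : NonZero p}} {k} → K % p ≡ k → ResidueCondition p k → p ∣ 24 * Sab
    24Sab-divisible p {k} K≡k residues = ∣-cancel-% p (24 * Sab) _ _ liouville-identity (∑dm≡K-cong-% p term)
      where
      term : ∀ d m → d * m ≡ K → (diagonalTerm d m + diagonalTerm m d) % p ≡ (compositionTerm d m + compositionTerm m d) % p
      term d m dm≡K with factors-suc d m dm≡K
      ... | d′ , m′ , refl , refl = begin
        (diagonalTerm (suc d′) (suc m′) + diagonalTerm (suc m′) (suc d′)) % p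
          ≡⟨ cong (_% p) (diagonalTerm-sym d′ m′) ⟩
        ⟦ symDiagonal ⟧ d′ m′ % p
          ≡⟨ ⟦⟧-% p symDiagonal d′ m′ ⟩
        ⟦ symDiagonal ⟧ (d′ % p) (m′ % p) % p
          ≡⟨ residues (m%n<n d′ p) (m%n<n m′ p) product≡k ⟩
        ⟦ symComposition ⟧ (d′ % p) (m′ % p) % p
          ≡⟨ ⟦⟧-% p symComposition d′ m′ ⟨
        ⟦ symComposition ⟧ d′ m′ % p
          ≡⟨ cong (_% p) (compositionTerm-sym d′ m′) ⟨
        (compositionTerm (suc d′) (suc m′) + compositionTerm (suc m′) (suc d′)) % p ∎
        where
        product≡k : ⟦ product ⟧ (d′ % p) (m′ % p) % p ≡ k
        product≡k = trans (sym (⟦⟧-% p product d′ m′))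
                          (trans (cong (_% p) (trans (sym (product-suc d′ m′)) dm≡K)) K≡k)

-- The congruences

n<1+2n : ∀ n → n < suc (2 * n)
n<1+2n n = s≤s (m≤m+n n (n + 0))

σeven*2-even : ∀ K → σeven*2 (2 * K) ≡ 4 * Liouville.Sab K (suc (2 * K)) (n<1+2n K)
σeven*2-even K = begin
  σeven*2 (2 * K)
    ≡⟨ σeven*2-∑₄ (2 * K) ⟩
  ∑₂ (λ a b → ∑₂ (λ x y → χ (2 * a * x + 2 * b * y ≟ 2 * K) * (sgn x * (2 * a) * (sgn y * (2 * b)))))
    ≡⟨ ∑₂-cong (λ a b → ∑₂-cong (λ x y → term a b x y)) ⟩
  ∑₂ (λ a b → ∑₂ (λ x y → 4 * (a * b * rep a b x y)))
    ≡⟨ ∑₂-cong (λ a b → trans (∑₂-*ˡ 4 (λ x y → a * b * rep a b x y)) (cong (4 *_) (∑₂-*ˡ (a * b) (rep a b)))) ⟩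
  ∑₂ (λ a b → 4 * (a * b * reps a b))
    ≡⟨ ∑₂-*ˡ 4 (λ a b → a * b * reps a b) ⟩
  4 * Sab ∎
  where
  open Liouville K (suc (2 * K)) (n<1+2n K)
  double : ∀ a b x y → 2 * (a * x + b * y) ≡ 2 * a * x + 2 * b * y
  double = solve-∀
  *-sgn : ∀ a → a * sgn a ≡ a
  *-sgn zero    = refl
  *-sgn (suc a) = *-identityʳ (suc a)
  regroup : ∀ c p q a b sa sb → c * (p * (2 * (a * sa)) * (q * (2 * (b * sb)))) ≡ 4 * (a * b * (sa * (sb * (p * (q * c)))))
  regroup = solve-∀
  term : ∀ a b x y → χ (2 * a * x + 2 * b * y ≟ 2 * K) * (sgn x * (2 * a) * (sgn y * (2 * b))) ≡ 4 * (a * b * rep a b x y)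
  term a b x y = begin
    χ (2 * a * x + 2 * b * y ≟ 2 * K) * (sgn x * (2 * a) * (sgn y * (2 * b)))
      ≡⟨ cong (_* (sgn x * (2 * a) * (sgn y * (2 * b)))) (χ-cong (_ ≟ 2 * K) (a * x + b * y ≟ K) halve double′) ⟩
    c * (sgn x * (2 * a) * (sgn y * (2 * b)))
      ≡⟨ cong₂ (λ u v → c * (sgn x * (2 * u) * (sgn y * (2 * v)))) (*-sgn a) (*-sgn b) ⟨
    c * (sgn x * (2 * (a * sgn a)) * (sgn y * (2 * (b * sgn b))))
      ≡⟨ regroup c (sgn x) (sgn y) a b (sgn a) (sgn b) ⟩
    4 * (a * b * rep a b x y) ∎
    where
    c = χ (a * x + b * y ≟ K)
    halve : 2 * a * x + 2 * b * y ≡ 2 * K → a * x + b * y ≡ K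
    halve eq = *-cancelˡ-≡ _ _ 2 (trans (double a b x y) eq)
    double′ : a * x + b * y ≡ K → 2 * a * x + 2 * b * y ≡ 2 * K
    double′ eq = trans (sym (double a b x y)) (cong (2 *_) eq)

σeven*2-even-divisible : ∀ p .{{_ : NonZero p}} K {k} → 1 ≤ K → K % p ≡ k → ResidueCondition p k → Coprime p 6 →
                         p ∣ σeven*2 (2 * K)
σeven*2-even-divisible p K 1≤K K≡k residues p⊥6 =
  coprime-divisor p⊥6 (subst (p ∣_) 24Sab≡6σ (24Sab-divisible 1≤K p K≡k residues))
  where
  open Liouville K (suc (2 * K)) (n<1+2n K)
  24Sab≡6σ : 24 * Sab ≡ 6 * σeven*2 (2 * K)
  24Sab≡6σ = trans (*-assoc 6 4 Sab) (cong (6 *_) (sym (σeven*2-even K)))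

σeven*2-odd-divisible : ∀ p K → p ∣ σeven*2 (suc (2 * K))
σeven*2-odd-divisible p K = subst (p ∣_) (sym (σeven*2-odd K)) (p ∣0)

even-or-odd : ∀ n → (∃ λ t → n ≡ 2 * t) ⊎ (∃ λ t → n ≡ suc (2 * t))
even-or-odd zero = inj₁ (0 , refl)
even-or-odd (suc n) with even-or-odd n
... | inj₁ (t , refl) = inj₂ (t , refl)
... | inj₂ (t , refl) = inj₁ (suc t , cong suc (sym (+-suc t (t + 0))))

5∣σeven*2[5n+2] : ∀ n → 5 ∣ σeven*2 (5 * n + 2)
5∣σeven*2[5n+2] n with even-or-odd n
... | inj₁ (t , refl) = subst (λ N → 5 ∣ σeven*2 N) (index t)
  (σeven*2-even-divisible 5 (1 + t * 5) (s≤s z≤n) ([m+kn]%n≡m%n 1 t 5)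
    (toWitness {a? = residueCondition? 5 1} _) (toWitness {a? = coprime? 5 6} _))
  where
  index : ∀ t → 2 * (1 + t * 5) ≡ 5 * (2 * t) + 2
  index = solve-∀
... | inj₂ (t , refl) = subst (λ N → 5 ∣ σeven*2 N) (index t) (σeven*2-odd-divisible 5 (3 + t * 5))
  where
  index : ∀ t → suc (2 * (3 + t * 5)) ≡ 5 * suc (2 * t) + 2
  index = solve-∀

7∣σeven*2[7n+5] : ∀ n → 7 ∣ σeven*2 (7 * n + 5)
7∣σeven*2[7n+5] n with even-or-odd n
... | inj₁ (t , refl) = subst (λ N → 7 ∣ σeven*2 N) (index t) (σeven*2-odd-divisible 7 (2 + t * 7))
  where
  index : ∀ t → suc (2 * (2 + t * 7)) ≡ 7 * (2 * t) + 5
  index = solve-∀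
... | inj₂ (t , refl) = subst (λ N → 7 ∣ σeven*2 N) (index t)
  (σeven*2-even-divisible 7 (6 + t * 7) (s≤s z≤n) ([m+kn]%n≡m%n 6 t 7)
    (toWitness {a? = residueCondition? 7 6} _) (toWitness {a? = coprime? 7 6} _))
  where
  index : ∀ t → 2 * (6 + t * 7) ≡ 7 * suc (2 * t) + 5
  index = solve-∀

corollary5p1 : (n : ℕ) → (5 ∣ σeven*2 (5 * n + 2)) × (7 ∣ σeven*2 (7 * n + 5))
corollary5p1 n = 5∣σeven*2[5n+2] n , 7∣σeven*2[7n+5] n
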